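{- For every positive integer $n$, $$\operatorname{adim}(P_3 \square P_n) \leq \begin{cases} n+1 & \text{if } n\equiv 1 \pmod 3,\\ n & \text{otherwise.}\end{cases}$$
   Context: $P_n$ is the path on $n$ vertices and $\square$ the Cartesian product of graphs: $V(G_1\square G_2)=V(G_1)\times V(G_2)$, with $(u,u')\sim(v,v')$ iff ($u=v$ and $u'v'\in E(G_2)$) or ($u'=v'$ and $uv\in E(G_1)$). For vertices $u,v$, $d(u,v)$ is the shortest-path distance and $d_1(u,v) := \min(d(u,v),2)$. A set $A \subseteq V(G)$ is an adjacency resolving set of $G$ if for any distinct $x,y \in V(G)$ there is $z \in A$ with $d_1(z,x) \neq d_1(z,y)$; $\operatorname{adim}(G)$ is the minimum cardinality of such a set. -}

module Defs where

open import Data.Nat using (ℕ; zero; suc; _≤_; _+_; _≡ᵇ_)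
open import Data.Nat.DivMod using (_%_)
open import Data.Fin using (Fin; toℕ)
import Data.Fin.Properties as FinP
open import Data.Product using (_×_; _,_; Σ; proj₁; proj₂)
open import Data.Product.Properties using (≡-dec)
open import Data.Sum using (_⊎_; inj₁; inj₂)
open import Data.List using (List; length)
open import Data.List.Membership.Propositional using (_∈_)
open import Data.List.Relation.Unary.Unique.Propositional using (Unique)
open import Relation.Nullary using (Dec; yes; no; ¬_)
open import Relation.Nullary.Decidable using (_×-dec_; _⊎-dec_)
open import Relation.Binary.PropositionalEquality using (_≡_; _≢_)
import Data.Nat.Properties as NatP

record Graph : Set₁ where
  field
    V    : Set
    _~_  : V → V → Set
    _≟_  : (u v : V) → Dec (u ≡ v)
    _~?_ : (u v : V) → Dec (u ~ v)

open Graph public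

P : ℕ → Graph
P n = record
  { V    = Fin n
  ; _~_  = λ i j → (suc (toℕ i) ≡ toℕ j) ⊎ (suc (toℕ j) ≡ toℕ i)
  ; _≟_  = FinP._≟_
  ; _~?_ = λ i j → (suc (toℕ i) NatP.≟ toℕ j) ⊎-dec (suc (toℕ j) NatP.≟ toℕ i)
  }

_□_ : Graph → Graph → Graph
G₁ □ G₂ = record
  { V    = V G₁ × V G₂
  ; _~_  = λ { (u , u′) (v , v′) →
               (u ≡ v × _~_ G₂ u′ v′) ⊎ (u′ ≡ v′ × _~_ G₁ u v) }
  ; _≟_  = ≡-dec (_≟_ G₁) (_≟_ G₂)
  ; _~?_ = λ { (u , u′) (v , v′) →
               ((_≟_ G₁ u v) ×-dec (_~?_ G₂ u′ v′))
               ⊎-dec ((_≟_ G₂ u′ v′) ×-dec (_~?_ G₁ u v)) }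
  }

-- d₁(u,v) = min(d(u,v), 2) where d is the shortest-path distance
-- (d = ∞ for disconnected vertices).  In a simple graph, d(u,v) = 0 iff
-- u = v and d(u,v) = 1 iff u ~ v; otherwise min(d,2) = 2.
d₁ : (G : Graph) → V G → V G → ℕ
d₁ G u v with _≟_ G u v
... | yes _ = 0
... | no _ with _~?_ G u v
...   | yes _ = 1
...   | no _  = 2

IsAdjResolving : (G : Graph) → List (V G) → Set
IsAdjResolving G A =
  (x y : V G) → x ≢ y → Σ (V G) λ z → z ∈ A × d₁ G z x ≢ d₁ G z y

AdimLE : Graph → ℕ → Set
AdimLE G k =
  Σ (List (V G)) λ A → Unique A × IsAdjResolving G A × length A ≤ k

bound : ℕ → ℕ
bound n with n % 3
... | 1 = suc n
... | _ = n

{-# OPTIONS --safe #-}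
-- Vertices are (row, column). The resolving set is built three columns at a time:
-- the block {(0,1),(2,1),(1,2)} occupies columns 0–2 and a resolving set of the grid
-- with three fewer columns is shifted to its right. The block dominates exactly the
-- vertices of columns 0–3 other than (1,0), (0,3), (2,3), and resolves any two
-- vertices it dominates; a dominated vertex is resolved from an undominated one by
-- its dominator. The vertices the block misses are (1,0) and the shifts of old
-- vertices other than (1,0), and these are resolved by the shifted old set as long
-- as it dominates every old vertex except (1,0). Grids with 1, 2, 3 columns start
-- the induction with 2, 2, 3 vertices, and each step adds three columns and three
-- vertices.
module Submission where

open import Defs
open import Data.Nat using (ℕ; zero; suc; _+_)
import Data.Nat.Properties as ℕ
open import Data.Nat.DivMod using (_%_)
open import Data.Fin using (Fin; zero; suc; _↑ˡ_)
import Data.Fin.Properties as Fin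
open import Data.Product using (_×_; _,_; Σ)
open import Data.Sum using (_⊎_; inj₁; inj₂)
open import Data.Empty using (⊥-elim)
open import Data.List using (List; []; _∷_; _++_; map; length)
open import Data.List.Properties using (length-map)
open import Data.List.Membership.Propositional using (_∈_; find; lose)
open import Data.List.Membership.Propositional.Properties using (∈-map⁺; ∈-map⁻; ∈-++⁺ˡ; ∈-++⁺ʳ)
open import Data.List.Relation.Unary.Any using (here; there; any?)
open import Data.List.Relation.Unary.Unique.Propositional using (Unique)
import Data.List.Relation.Unary.Unique.Propositional.Properties as Unique
open import Data.List.Relation.Unary.Unique.DecPropositional using (unique?)
open import Relation.Nullary using (Dec; yes; no; ¬_; ¬?)
open import Relation.Nullary.Decidable using (toWitness; map′; _×-dec_; _→-dec_; decidable-stable)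
open import Relation.Binary.PropositionalEquality using (_≡_; _≢_; refl; sym; trans; cong; module ≡-Reasoning)

module _ (G : Graph) where

  d₁-≡ : ∀ {u v} → u ≡ v → d₁ G u v ≡ 0
  d₁-≡ {u} {v} u≡v with _≟_ G u v
  ... | yes _ = refl
  ... | no u≢v = ⊥-elim (u≢v u≡v)

  d₁-~ : ∀ {u v} → u ≢ v → _~_ G u v → d₁ G u v ≡ 1
  d₁-~ {u} {v} u≢v u~v with _≟_ G u v
  ... | yes u≡v = ⊥-elim (u≢v u≡v)
  ... | no _ with _~?_ G u v
  ...   | yes _ = refl
  ...   | no u≁v = ⊥-elim (u≁v u~v)

  d₁-≁ : ∀ {u v} → u ≢ v → ¬ _~_ G u v → d₁ G u v ≡ 2
  d₁-≁ {u} {v} u≢v u≁v with _≟_ G u v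
  ... | yes u≡v = ⊥-elim (u≢v u≡v)
  ... | no _ with _~?_ G u v
  ...   | yes u~v = ⊥-elim (u≁v u~v)
  ...   | no _ = refl

  Resolves : List (V G) → V G → V G → Set
  Resolves A x y = Σ (V G) λ z → z ∈ A × d₁ G z x ≢ d₁ G z y

  Dominates : List (V G) → V G → Set
  Dominates A x = Σ (V G) λ z → z ∈ A × d₁ G z x ≢ 2

  DominatesAllBut : List (V G) → V G → Set
  DominatesAllBut A v = ∀ x → x ≢ v → Dominates A x

  resolves? : ∀ A x y → Dec (Resolves A x y)
  resolves? A x y = map′ find (λ (_ , z∈A , p) → lose z∈A p)
    (any? (λ z → ¬? (d₁ G z x ℕ.≟ d₁ G z y)) A)

  dominates? : ∀ A x → Dec (Dominates A x)
  dominates? A x = map′ find (λ (_ , z∈A , p) → lose z∈A p)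
    (any? (λ z → ¬? (d₁ G z x ℕ.≟ 2)) A)

  resolves-sym : ∀ {A x y} → Resolves A x y → Resolves A y x
  resolves-sym (z , z∈A , p) = z , z∈A , λ e → p (sym e)

  resolves-mono : ∀ {A B x y} → (∀ {z} → z ∈ A → z ∈ B) → Resolves A x y → Resolves B x y
  resolves-mono A⊆B (z , z∈A , p) = z , A⊆B z∈A , p

  dominates-mono : ∀ {A B x} → (∀ {z} → z ∈ A → z ∈ B) → Dominates A x → Dominates B x
  dominates-mono A⊆B (z , z∈A , p) = z , A⊆B z∈A , p

  dominated-resolves-undominated : ∀ {A x y} → Dominates A x → ¬ Dominates A y → Resolves A x y
  dominated-resolves-undominated {y = y} (z , z∈A , zx≢2) ¬dy = z , z∈A , λ zx≡zy →
    zx≢2 (trans zx≡zy (decidable-stable (d₁ G z y ℕ.≟ 2) (λ zy≢2 → ¬dy (z , z∈A , zy≢2))))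

record InducedEmbedding (G H : Graph) : Set where
  field
    to        : V G → V H
    injective : ∀ {u v} → to u ≡ to v → u ≡ v
    adjacent⁺ : ∀ {u v} → _~_ G u v → _~_ H (to u) (to v)
    adjacent⁻ : ∀ {u v} → _~_ H (to u) (to v) → _~_ G u v

module _ {G H : Graph} (e : InducedEmbedding G H) where
  open InducedEmbedding e

  d₁-embedding : ∀ u v → d₁ H (to u) (to v) ≡ d₁ G u v
  d₁-embedding u v = compare (_≟_ G u v) (_~?_ G u v)
    where
    compare : Dec (u ≡ v) → Dec (_~_ G u v) → d₁ H (to u) (to v) ≡ d₁ G u v
    compare (yes u≡v) _ = trans (d₁-≡ H (cong to u≡v)) (sym (d₁-≡ G u≡v))
    compare (no u≢v) (yes u~v) =
      trans (d₁-~ H (λ e → u≢v (injective e)) (adjacent⁺ u~v)) (sym (d₁-~ G u≢v u~v))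
    compare (no u≢v) (no u≁v) =
      trans (d₁-≁ H (λ e → u≢v (injective e)) (λ a → u≁v (adjacent⁻ a))) (sym (d₁-≁ G u≢v u≁v))

  resolves-image : ∀ {A x y} → Resolves G A x y → Resolves H (map to A) (to x) (to y)
  resolves-image {x = x} {y} (z , z∈A , p) =
    to z , ∈-map⁺ to z∈A , λ e → p (trans (sym (d₁-embedding z x)) (trans e (d₁-embedding z y)))

  dominates-image : ∀ {A x} → Dominates G A x → Dominates H (map to A) (to x)
  dominates-image {x = x} (z , z∈A , p) =
    to z , ∈-map⁺ to z∈A , λ e → p (trans (sym (d₁-embedding z x)) e)

Grid : ℕ → Graph
Grid m = P 3 □ P m

leftMiddle : ∀ {m} → V (Grid (suc m))
leftMiddle = suc zero , zero

∀-vertex? : ∀ {m} {Q : V (Grid m) → Set} → (∀ v → Dec (Q v)) → Dec (∀ v → Q v)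
∀-vertex? Q? = map′ (λ h (r , c) → h r c) (λ h r c → h (r , c))
  (Fin.all? λ r → Fin.all? λ c → Q? (r , c))

shift : ∀ {m} → V (Grid m) → V (Grid (3 + m))
shift (r , c) = r , suc (suc (suc c))

shiftEmbedding : ∀ {m} → InducedEmbedding (Grid m) (Grid (3 + m))
shiftEmbedding = record
  { to        = shift
  ; injective = λ { refl → refl }
  ; adjacent⁺ = λ { (inj₁ (r≡r′ , inj₁ c~c′)) → inj₁ (r≡r′ , inj₁ (cong (3 +_) c~c′))
                  ; (inj₁ (r≡r′ , inj₂ c′~c)) → inj₁ (r≡r′ , inj₂ (cong (3 +_) c′~c))
                  ; (inj₂ (refl , r~r′))      → inj₂ (refl , r~r′) }
  ; adjacent⁻ = λ { (inj₁ (r≡r′ , inj₁ c~c′)) → inj₁ (r≡r′ , inj₁ (ℕ.+-cancelˡ-≡ 3 _ _ c~c′))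
                  ; (inj₁ (r≡r′ , inj₂ c′~c)) → inj₁ (r≡r′ , inj₂ (ℕ.+-cancelˡ-≡ 3 _ _ c′~c))
                  ; (inj₂ (refl , r~r′))      → inj₂ (refl , r~r′) }
  }

block : ∀ {m} → List (V (Grid (3 + m)))
block = (zero , suc zero) ∷ (suc (suc zero) , suc zero) ∷ (suc zero , suc (suc zero)) ∷ []

-- The finite facts below are decided by evaluation although k is a variable:
-- block only sees columns 0–3, and columns from 4 on are all treated alike.
module Block {k : ℕ} where

  Gₖ : Graph
  Gₖ = Grid (3 + suc k)

  near : V (Grid 4) → V Gₖ
  near (r , c) = r , c ↑ˡ k

  inBlock : V (Grid 3) → V Gₖ
  inBlock (r , c) = r , c ↑ˡ suc k

  block-resolves-near : ∀ x y → near x ≢ near y →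
    Dominates Gₖ block (near x) → Dominates Gₖ block (near y) → Resolves Gₖ block (near x) (near y)
  block-resolves-near = toWitness {a? = ∀-vertex? λ x → ∀-vertex? λ y →
    ¬? (_≟_ Gₖ (near x) (near y)) →-dec (dominates? Gₖ block (near x) →-dec
      (dominates? Gₖ block (near y) →-dec resolves? Gₖ block (near x) (near y)))} _

  far-undominated : ∀ (c : Fin k) r → ¬ Dominates Gₖ block (r , suc (suc (suc (suc c))))
  far-undominated c = toWitness {a? = Fin.all? λ r →
    ¬? (dominates? Gₖ block (r , suc (suc (suc (suc c)))))} _

  dominated-near : ∀ {v} → Dominates Gₖ block v → Σ (V (Grid 4)) λ x → near x ≡ v
  dominated-near {r , zero} _ = (r , zero) , refl
  dominated-near {r , suc zero} _ = (r , suc zero) , refl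
  dominated-near {r , suc (suc zero)} _ = (r , suc (suc zero)) , refl
  dominated-near {r , suc (suc (suc zero))} _ = (r , suc (suc (suc zero))) , refl
  dominated-near {r , suc (suc (suc (suc c)))} d = ⊥-elim (far-undominated c r d)

  block-resolves-dominated : ∀ {x y} → x ≢ y →
    Dominates Gₖ block x → Dominates Gₖ block y → Resolves Gₖ block x y
  block-resolves-dominated x≢y dx dy with dominated-near dx | dominated-near dy
  ... | x , refl | y , refl = block-resolves-near x y x≢y dx dy

  undominated-in-block : ∀ x → ¬ Dominates Gₖ block (inBlock x) → inBlock x ≡ leftMiddle
  undominated-in-block = toWitness {a? = ∀-vertex? λ x →
    ¬? (dominates? Gₖ block (inBlock x)) →-dec (_≟_ Gₖ (inBlock x) leftMiddle)} _

  Undominated : V Gₖ → Set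
  Undominated v = v ≡ leftMiddle ⊎ Σ (V (Grid (suc k))) λ v′ → shift v′ ≡ v × v′ ≢ leftMiddle

  undominated : ∀ v → ¬ Dominates Gₖ block v → Undominated v
  undominated (r , zero) ¬d = inj₁ (undominated-in-block (r , zero) ¬d)
  undominated (r , suc zero) ¬d = inj₁ (undominated-in-block (r , suc zero) ¬d)
  undominated (r , suc (suc zero)) ¬d = inj₁ (undominated-in-block (r , suc (suc zero)) ¬d)
  undominated (r , suc (suc (suc c))) ¬d with _≟_ (Grid (suc k)) (r , c) leftMiddle
  ... | yes refl = ⊥-elim (¬d (toWitness {a? = dominates? Gₖ block (shift leftMiddle)} _))
  ... | no v′≢leftMiddle = inj₂ ((r , c) , refl , v′≢leftMiddle)

  leftMiddle-undominated-by-shifted : ∀ A → ¬ Dominates Gₖ (map shift A) leftMiddle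
  leftMiddle-undominated-by-shifted A (z , z∈A , p) with ∈-map⁻ shift z∈A
  ... | (r , c) , _ , refl = p (d₁-≁ Gₖ {r , suc (suc (suc c))} {leftMiddle} (λ ()) λ
    { (inj₁ (_ , inj₁ ())) ; (inj₁ (_ , inj₂ ())) ; (inj₂ (() , _)) })

  block-disjoint-shifted : ∀ A {v} → ¬ (v ∈ block × v ∈ map shift A)
  block-disjoint-shifted A (v∈block , v∈A) with ∈-map⁻ (shift {suc k}) v∈A
  block-disjoint-shifted A (here refl , _) | _ , _ , ()
  block-disjoint-shifted A (there (here refl) , _) | _ , _ , ()
  block-disjoint-shifted A (there (there (here refl)) , _) | _ , _ , ()

Admissible : ∀ k → List (V (Grid (suc k))) → Set
Admissible k A =
  Unique A × IsAdjResolving (Grid (suc k)) A × DominatesAllBut (Grid (suc k)) A leftMiddle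

admissible? : ∀ k A → Dec (Admissible k A)
admissible? k A =
  unique? (_≟_ G) A
    ×-dec (∀-vertex? λ x → ∀-vertex? λ y → ¬? (_≟_ G x y) →-dec resolves? G A x y)
    ×-dec (∀-vertex? λ x → ¬? (_≟_ G x leftMiddle) →-dec dominates? G A x)
  where G = Grid (suc k)

extend : ∀ {m} → List (V (Grid m)) → List (V (Grid (3 + m)))
extend A = block ++ map shift A

module Extend {k : ℕ} {A : List (V (Grid (suc k)))} where
  open Block {k}

  shifted-resolves-leftMiddle : ∀ {y} → Dominates (Grid (suc k)) A y →
    Resolves Gₖ (extend A) (shift y) leftMiddle
  shifted-resolves-leftMiddle dy = resolves-mono Gₖ (∈-++⁺ʳ block)
    (dominated-resolves-undominated Gₖ (dominates-image shiftEmbedding dy)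
      (leftMiddle-undominated-by-shifted A))

  resolves-undominated : IsAdjResolving (Grid (suc k)) A → DominatesAllBut (Grid (suc k)) A leftMiddle →
    ∀ {x y} → x ≢ y → Undominated x → Undominated y → Resolves Gₖ (extend A) x y
  resolves-undominated R D x≢y (inj₁ refl) (inj₁ refl) = ⊥-elim (x≢y refl)
  resolves-undominated R D x≢y (inj₁ refl) (inj₂ (y′ , refl , y′≢)) =
    resolves-sym Gₖ (shifted-resolves-leftMiddle (D y′ y′≢))
  resolves-undominated R D x≢y (inj₂ (x′ , refl , x′≢)) (inj₁ refl) =
    shifted-resolves-leftMiddle (D x′ x′≢)
  resolves-undominated R D x≢y (inj₂ (x′ , refl , _)) (inj₂ (y′ , refl , _)) =
    resolves-mono Gₖ (∈-++⁺ʳ block)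
      (resolves-image shiftEmbedding (R x′ y′ λ x′≡y′ → x≢y (cong shift x′≡y′)))

  extend-resolving : IsAdjResolving (Grid (suc k)) A → DominatesAllBut (Grid (suc k)) A leftMiddle →
    IsAdjResolving Gₖ (extend A)
  extend-resolving R D x y x≢y with dominates? Gₖ block x | dominates? Gₖ block y
  ... | yes dx | yes dy = resolves-mono Gₖ ∈-++⁺ˡ (block-resolves-dominated x≢y dx dy)
  ... | yes dx | no ¬dy = resolves-mono Gₖ ∈-++⁺ˡ (dominated-resolves-undominated Gₖ dx ¬dy)
  ... | no ¬dx | yes dy =
    resolves-mono Gₖ ∈-++⁺ˡ (resolves-sym Gₖ (dominated-resolves-undominated Gₖ dy ¬dx))
  ... | no ¬dx | no ¬dy = resolves-undominated R D x≢y (undominated x ¬dx) (undominated y ¬dy)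

  extend-dominating : DominatesAllBut (Grid (suc k)) A leftMiddle →
    DominatesAllBut Gₖ (extend A) leftMiddle
  extend-dominating D v v≢leftMiddle with dominates? Gₖ block v
  ... | yes dv = dominates-mono Gₖ ∈-++⁺ˡ dv
  ... | no ¬dv with undominated v ¬dv
  ...   | inj₁ v≡leftMiddle = ⊥-elim (v≢leftMiddle v≡leftMiddle)
  ...   | inj₂ (v′ , refl , v′≢) =
    dominates-mono Gₖ (∈-++⁺ʳ block) (dominates-image shiftEmbedding (D v′ v′≢))

  extend-unique : Unique A → Unique (extend A)
  extend-unique U = Unique.++⁺ (toWitness {a? = unique? (_≟_ Gₖ) block} _)
    (Unique.map⁺ (InducedEmbedding.injective shiftEmbedding) U) (block-disjoint-shifted A)

  extend-admissible : Admissible k A → Admissible (3 + k) (extend A)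
  extend-admissible (U , R , D) = extend-unique U , extend-resolving R D , extend-dominating D

open Extend using (extend-admissible)

resolvingSet : ∀ k → List (V (Grid (suc k)))
resolvingSet 0 = (zero , zero) ∷ (suc zero , zero) ∷ []
resolvingSet 1 = (zero , suc zero) ∷ (suc (suc zero) , suc zero) ∷ []
resolvingSet 2 = block
resolvingSet (suc (suc (suc k))) = extend (resolvingSet k)

resolvingSet-admissible : ∀ k → Admissible k (resolvingSet k)
resolvingSet-admissible 0 = toWitness {a? = admissible? 0 (resolvingSet 0)} _
resolvingSet-admissible 1 = toWitness {a? = admissible? 1 (resolvingSet 1)} _
resolvingSet-admissible 2 = toWitness {a? = admissible? 2 (resolvingSet 2)} _
resolvingSet-admissible (suc (suc (suc k))) = extend-admissible (resolvingSet-admissible k)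

bound-+3 : ∀ n → bound (3 + n) ≡ 3 + bound n
bound-+3 n with n % 3
... | 0 = refl
... | 1 = refl
... | suc (suc _) = refl

length-resolvingSet : ∀ k → length (resolvingSet k) ≡ bound (suc k)
length-resolvingSet 0 = refl
length-resolvingSet 1 = refl
length-resolvingSet 2 = refl
length-resolvingSet (suc (suc (suc k))) = begin
  3 + length (map shift (resolvingSet k)) ≡⟨ cong (3 +_) (length-map shift (resolvingSet k)) ⟩
  3 + length (resolvingSet k)             ≡⟨ cong (3 +_) (length-resolvingSet k) ⟩
  3 + bound (suc k)                       ≡⟨ sym (bound-+3 (suc k)) ⟩
  bound (3 + suc k)                       ∎
  where open ≡-Reasoning

lemma4p14 : (n : ℕ) → AdimLE (P 3 □ P (suc n)) (bound (suc n))
lemma4p14 n =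
  let unique , resolving , _ = resolvingSet-admissible n
  in resolvingSet n , unique , resolving , ℕ.≤-reflexive (length-resolvingSet n)
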